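{- $\mathsf{wRSgr}\le_\mathrm{c}\mathsf{wRSg}$. Hence $\mathsf{wRSg}\equiv_\mathrm{c}\mathsf{wRSgr}$.
   Context: For problems (multi-valued partial functions $\subseteq\omega^\omega\rightrightarrows\omega^\omega$), $\mathcal F\le_\mathrm{c}\mathcal G$ (computable reducibility) if for every $f\in\mathrm{dom}(\mathcal F)$ there is $\hat f\le_\mathrm{T}f$ with $\hat f\in\mathrm{dom}(\mathcal G)$ such that for every $\hat g\in\mathcal G(\hat f)$ there is $g\le_\mathrm{T}f\oplus\hat g$ with $g\in\mathcal F(f)$; $\equiv_\mathrm{c}$ is reducibility both ways. Graphs $G=(V,E)$ are simple with $V\subseteq\omega$ infinite, $E\subseteq[V]^2$; $N(v)=\{y:(v,y)\in E\}$. $\mathsf{wRSg}$: input an infinite graph $G=(V,E)$; output an infinite $H\subseteq V$ with, for all $v\in H$, $|H\cap N(v)|=\omega$ or $|H\cap N(v)|\le1$. $\mathsf{wRSgr}$: same input; output an infinite $H\subseteq V$ with, for all $v\in H$, $|H\cap N(v)|=\omega$ or $|H\cap N(v)|=0$. -}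

module Defs where

open import Data.Nat using (ℕ; zero; suc; _+_; _≤_; _<_)
open import Data.Bool using (Bool; true; false; if_then_else_)
open import Data.Fin using (Fin)
open import Data.Vec using (Vec; []; _∷_; head; lookup; tabulate)
open import Data.Product using (Σ; _×_; _,_)
open import Data.Sum using (_⊎_)
open import Relation.Binary.PropositionalEquality using (_≡_; _≢_)
open import Relation.Nullary using (¬_)

Baire : Set
Baire = ℕ → ℕ

-- Relative computability: total functions ℕ^k → ℕ that are (general)
-- recursive in an oracle f (Kleene's schemes with regular minimisation).

primrec : {k : ℕ} → (Vec ℕ k → ℕ) → (Vec ℕ (suc (suc k)) → ℕ) → Vec ℕ (suc k) → ℕ
primrec g h (zero ∷ xs)  = g xs
primrec g h (suc n ∷ xs) = h (primrec g h (n ∷ xs) ∷ n ∷ xs)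

data Comp (f : Baire) : (k : ℕ) → (Vec ℕ k → ℕ) → Set where
  zeroC   : {k : ℕ} → Comp f k (λ _ → 0)
  sucC    : Comp f 1 (λ xs → suc (head xs))
  projC   : {k : ℕ} (i : Fin k) → Comp f k (λ xs → lookup xs i)
  oracleC : Comp f 1 (λ xs → f (head xs))
  compC   : {k m : ℕ} {g : Vec ℕ m → ℕ} {hs : Fin m → Vec ℕ k → ℕ} →
            Comp f m g → ((i : Fin m) → Comp f k (hs i)) →
            Comp f k (λ xs → g (tabulate (λ i → hs i xs)))
  primrecC : {k : ℕ} {g : Vec ℕ k → ℕ} {h : Vec ℕ (suc (suc k)) → ℕ} →
             Comp f k g → Comp f (suc (suc k)) h → Comp f (suc k) (primrec g h)
  minC    : {k : ℕ} {g : Vec ℕ (suc k) → ℕ} → Comp f (suc k) g →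
            (r : Vec ℕ k → ℕ) →
            (∀ xs → g (r xs ∷ xs) ≡ 0) →
            (∀ xs y → y < r xs → g (y ∷ xs) ≢ 0) →
            Comp f k r
  extC    : {k : ℕ} {g h : Vec ℕ k → ℕ} → Comp f k g → (∀ xs → g xs ≡ h xs) → Comp f k h

_≤T_ : Baire → Baire → Set
g ≤T f = Comp f 1 (λ xs → g (head xs))

isEven : ℕ → Bool
isEven zero = true
isEven (suc zero) = false
isEven (suc (suc n)) = isEven n

half : ℕ → ℕ
half zero = 0
half (suc zero) = 0
half (suc (suc n)) = suc (half n)

_⊕_ : Baire → Baire → Baire
(f ⊕ g) n = if isEven n then f (half n) else g (half n)

-- Problems (multi-valued partial functions ω^ω ⇉ ω^ω) and computable reducibility

record Problem : Set₁ where
  field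
    dom : Baire → Set
    sol : Baire → Baire → Set
open Problem public

_≤c_ : Problem → Problem → Set
F ≤c G = (f : Baire) → dom F f →
  Σ Baire λ f̂ → f̂ ≤T f × dom G f̂ ×
    ((ĝ : Baire) → sol G f̂ ĝ → Σ Baire λ g → g ≤T (f ⊕ ĝ) × sol F f g)

_≡c_ : Problem → Problem → Set
F ≡c G = (F ≤c G) × (G ≤c F)

Infinite : (ℕ → Set) → Set
Infinite S = (n : ℕ) → Σ ℕ λ m → n ≤ m × S m

AtMostOne : (ℕ → Set) → Set
AtMostOne S = (x y : ℕ) → S x → S y → x ≡ y

Empty : (ℕ → Set) → Set
Empty S = (x : ℕ) → ¬ S x

tri : ℕ → ℕ
tri zero = 0
tri (suc n) = suc n + tri n

pair : ℕ → ℕ → ℕ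
pair a b = tri (a + b) + b

-- a code c : Baire describes V = {v : c⟨v,v⟩ = 1},
-- E = {{u,v} : u ≠ v, c⟨u,v⟩ = 1}
Vtx : Baire → ℕ → Set
Vtx c v = c (pair v v) ≡ 1

Edge : Baire → ℕ → ℕ → Set
Edge c u v = u ≢ v × c (pair u v) ≡ 1

IsInfGraph : Baire → Set
IsInfGraph c = Infinite (Vtx c)
             × (∀ u v → Edge c u v → Edge c v u)
             × (∀ u v → Edge c u v → Vtx c u × Vtx c v)

Nbr : Baire → ℕ → ℕ → Set
Nbr c v y = Edge c v y

Mem : Baire → ℕ → Set
Mem h x = h x ≡ 1

HcapN : Baire → Baire → ℕ → ℕ → Set
HcapN c h v y = Mem h y × Nbr c v y

wRSg : Problem
wRSg = record
  { dom = IsInfGraph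
  ; sol = λ c h → (∀ x → Mem h x → Vtx c x) × Infinite (Mem h)
                × (∀ v → Mem h v → Infinite (HcapN c h v) ⊎ AtMostOne (HcapN c h v)) }

wRSgr : Problem
wRSgr = record
  { dom = IsInfGraph
  ; sol = λ c h → (∀ x → Mem h x → Vtx c x) × Infinite (Mem h)
                × (∀ v → Mem h v → Infinite (HcapN c h v) ⊎ Empty (HcapN c h v)) }

-- The direction  wRSg ≤c wRSgr  is immediate: a set in which every vertex
-- has zero or infinitely many neighbours in it is also a wRSg-solution.
-- For  wRSgr ≤c wRSg , let H be a wRSg-solution for the graph G and call
-- v ∈ H rich if it has infinitely many H-neighbours; a poor v ∈ H has at
-- most one.  Using excluded middle we distinguish three cases, in each of
-- which a wRSgr-solution is computable from  G ⊕ H :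
--  (A) some v ∈ H has infinitely many poor H-neighbours: the greedy
--      independent subset of  H ∩ N(v)  contains all of them;
--  (B) otherwise, if some d ∈ H is rich, every rich vertex of H has
--      infinitely many rich H-neighbours; from d we grow an infinitely
--      branching tree of vertices of H, each adjacent to its parent, whose
--      labels form a decidable set in which every degree is infinite
--      (richness is certified computably by two distinct H-neighbours);
--  (C) if no vertex of H is rich, the greedy independent subset of H is
--      infinite by the pigeonhole principle.

module Submission where

open import Defs
open import Level using (0ℓ)
open import Axiom.ExcludedMiddle using (ExcludedMiddle)
open import Axiom.DoubleNegationElimination using (DoubleNegationElimination; em⇒dne)
open import Data.Nat using (ℕ; zero; suc; _+_; _*_; _∸_; _≤_; _<_; z≤n; s≤s; s≤s⁻¹; pred; _<ᵇ_; _≡ᵇ_)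
open import Data.Nat.Properties
open import Data.Bool using (Bool; true; false; if_then_else_; _∧_; _∨_; not; T)
open import Data.Unit using (tt)
open import Data.Fin using (Fin; zero; suc; toℕ; fromℕ<)
open import Data.Fin.Properties using (pigeonhole; toℕ-fromℕ<)
open import Data.Vec using (Vec; []; _∷_; head; tail; lookup; tabulate)
open import Data.Vec.Properties using (tabulate∘lookup)
open import Data.Product using (Σ; _×_; _,_; proj₁; proj₂)
open import Data.Sum using (_⊎_; inj₁; inj₂)
open import Data.Empty using (⊥; ⊥-elim)
open import Relation.Binary.Definitions using (tri<; tri≈; tri>)
open import Relation.Binary.PropositionalEquality
open import Relation.Nullary using (¬_; yes; no)

-- Boolean tests and the relations they decide.  Computable predicates are
-- Boolean-valued, so every decidable property is used in both forms.

-- Characteristic value of a Boolean; a set of naturals is coded by  bit ∘ p.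
bit : Bool → ℕ
bit true = 1
bit false = 0

bit-true : ∀ {b} → bit b ≡ 1 → b ≡ true
bit-true {true} _ = refl

true-bit : ∀ {b} → b ≡ true → bit b ≡ 1
true-bit refl = refl

T⇒≡true : ∀ {b} → T b → b ≡ true
T⇒≡true {true} _ = refl

≡true⇒T : ∀ {b} → b ≡ true → T b
≡true⇒T refl = tt

¬true⇒false : ∀ {b} → ¬ (b ≡ true) → b ≡ false
¬true⇒false {true} ¬t = ⊥-elim (¬t refl)
¬true⇒false {false} _ = refl

¬false⇒true : ∀ {b} → ¬ (b ≡ false) → b ≡ true
¬false⇒true {true} _ = refl
¬false⇒true {false} ¬f = ⊥-elim (¬f refl)

∧-split : ∀ {a b} → (a ∧ b) ≡ true → a ≡ true × b ≡ true
∧-split {true} e = refl , e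

∧-intro : ∀ {a b} → a ≡ true → b ≡ true → (a ∧ b) ≡ true
∧-intro refl refl = refl

not-true : ∀ {a} → not a ≡ true → a ≡ false
not-true {false} _ = refl

false-not : ∀ {a} → a ≡ false → not a ≡ true
false-not refl = refl

if-true : ∀ {A : Set} {b} {x y : A} → b ≡ true → (if b then x else y) ≡ x
if-true refl = refl

<ᵇ-true : ∀ {m n} → (m <ᵇ n) ≡ true → m < n
<ᵇ-true {m} {n} e = <ᵇ⇒< m n (≡true⇒T e)

<ᵇ-false : ∀ {m n} → (m <ᵇ n) ≡ false → n ≤ m
<ᵇ-false e = ≮⇒≥ λ m<n → subst T e (<⇒<ᵇ m<n)

<⇒<ᵇ-true : ∀ {m n} → m < n → (m <ᵇ n) ≡ true
<⇒<ᵇ-true m<n = T⇒≡true (<⇒<ᵇ m<n)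

≡ᵇ-true : ∀ {m n} → (m ≡ᵇ n) ≡ true → m ≡ n
≡ᵇ-true {m} {n} e = ≡ᵇ⇒≡ m n (≡true⇒T e)

≡ᵇ-false : ∀ {m n} → (m ≡ᵇ n) ≡ false → m ≢ n
≡ᵇ-false {m} {n} e m≡n = subst T e (≡⇒≡ᵇ m n m≡n)

≡⇒≡ᵇ-true : ∀ {m n} → m ≡ n → (m ≡ᵇ n) ≡ true
≡⇒≡ᵇ-true {m} {n} m≡n = T⇒≡true (≡⇒≡ᵇ m n m≡n)

≢⇒≡ᵇ-false : ∀ {m n} → m ≢ n → (m ≡ᵇ n) ≡ false
≢⇒≡ᵇ-false m≢n = ¬true⇒false λ e → m≢n (≡ᵇ-true e)

searchStep : ℕ → ℕ → Bool → ℕ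
searchStep r s b = if r <ᵇ s then r else (if b then s else suc s)

-- least p s  is the least y < s with  p y , or  s  if there is none.
-- It is primitive recursive in s, hence computable whenever p is.  It is
-- kept opaque so that goals mention the search rather than its unfolding;
-- the four facts below are its whole interface.
opaque
  least : (ℕ → Bool) → ℕ → ℕ
  least p zero = zero
  least p (suc s) = searchStep (least p s) s (p s)

  least-zero : ∀ p → least p zero ≡ zero
  least-zero p = refl

  least-suc : ∀ p s → least p (suc s) ≡ searchStep (least p s) s (p s)
  least-suc p s = refl

  least-minimal : ∀ p s y → y < least p s → p y ≡ false
  least-minimal p (suc s) y lt with least p s <ᵇ s in e
  ... | true = least-minimal p s y lt
  ... | false with p s in ps
  ... | true = least-minimal p s y (≤-trans lt (<ᵇ-false e))
  ... | false with m≤n⇒m<n∨m≡n (s≤s⁻¹ lt)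
  ...   | inj₁ y<s = least-minimal p s y (≤-trans y<s (<ᵇ-false e))
  ...   | inj₂ refl = ps

  least-hit : ∀ p s → least p s < s → p (least p s) ≡ true
  least-hit p (suc s) lt with least p s <ᵇ s in e
  ... | true = least-hit p s (<ᵇ-true e)
  ... | false with p s in ps
  ... | true = ps
  ... | false = ⊥-elim (<-irrefl refl lt)

least-≤-witness : ∀ p s y → p y ≡ true → y < s → least p s ≤ y
least-≤-witness p s y py y<s with ≤-<-connex (least p s) y
... | inj₁ le = le
... | inj₂ lt with trans (sym py) (least-minimal p s y lt)
... | ()

least-found : ∀ p s y → p y ≡ true → y < s → p (least p s) ≡ true
least-found p s y py y<s = least-hit p s (≤-<-trans (least-≤-witness p s y py y<s) y<s)

any< : (ℕ → Bool) → ℕ → Bool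
any< p s = least p s <ᵇ s

any<-intro : ∀ p s y → p y ≡ true → y < s → any< p s ≡ true
any<-intro p s y py y<s = <⇒<ᵇ-true (≤-<-trans (least-≤-witness p s y py y<s) y<s)

any<-elim : ∀ p s → any< p s ≡ true → Σ ℕ λ y → y < s × p y ≡ true
any<-elim p s e = least p s , <ᵇ-true e , least-hit p s (<ᵇ-true e)

n≤tri : ∀ n → n ≤ tri n
n≤tri zero = z≤n
n≤tri (suc n) = m≤m+n (suc n) (tri n)

tri-mono : ∀ {m n} → m ≤ n → tri m ≤ tri n
tri-mono {zero} _ = z≤n
tri-mono {suc m} {suc n} (s≤s m≤n) = +-mono-≤ (s≤s m≤n) (tri-mono m≤n)

pair-≥₁ : ∀ a b → a ≤ pair a b
pair-≥₁ a b = ≤-trans (m≤m+n a b) (≤-trans (n≤tri (a + b)) (m≤m+n (tri (a + b)) b))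

pair-≥₂ : ∀ a b → b ≤ pair a b
pair-≥₂ a b = m≤n+m b (tri (a + b))

pair-<-sum : ∀ a b a' b' → a + b < a' + b' → pair a b < pair a' b'
pair-<-sum a b a' b' lt = begin-strict
    tri (a + b) + b        ≤⟨ +-monoʳ-≤ (tri (a + b)) (m≤n+m b a) ⟩
    tri (a + b) + (a + b)  <⟨ ≤-refl ⟩
    suc (tri (a + b) + (a + b)) ≡⟨ cong suc (+-comm (tri (a + b)) (a + b)) ⟩
    tri (suc (a + b))      ≤⟨ tri-mono lt ⟩
    tri (a' + b')          ≤⟨ m≤m+n (tri (a' + b')) b' ⟩
    tri (a' + b') + b'     ∎
  where open ≤-Reasoning

pair-injective : ∀ a b a' b' → pair a b ≡ pair a' b' → a ≡ a' × b ≡ b'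
pair-injective a b a' b' e with <-cmp (a + b) (a' + b')
... | tri< lt _ _ = ⊥-elim (<-irrefl e (pair-<-sum a b a' b' lt))
... | tri> _ _ gt = ⊥-elim (<-irrefl (sym e) (pair-<-sum a' b' a b gt))
... | tri≈ _ sums _ = a≡a' , b≡b'
  where
    b≡b' : b ≡ b'
    b≡b' = +-cancelˡ-≡ (tri (a + b)) b b' (trans e (cong (λ m → tri m + b') (sym sums)))
    a≡a' : a ≡ a'
    a≡a' = +-cancelʳ-≡ b a a' (trans sums (cong (a' +_) (sym b≡b')))

-- The inverses search below  z + 1 , which bounds both coordinates of  z .
unpair₁ : ℕ → ℕ
unpair₁ z = least (λ a → any< (λ b → pair a b ≡ᵇ z) (suc z)) (suc z)

unpair₂ : ℕ → ℕ
unpair₂ z = least (λ b → pair (unpair₁ z) b ≡ᵇ z) (suc z)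

-- The search for a first coordinate with a partner stops at or before a;
-- injectivity then identifies what it found with a.
unpair₁-pair : ∀ a b → unpair₁ (pair a b) ≡ a
unpair₁-pair a b = proj₁ (pair-injective (unpair₁ z) b' a b (≡ᵇ-true hit))
  where
    z = pair a b
    hasPartner : ℕ → Bool
    hasPartner a' = any< (λ b' → pair a' b' ≡ᵇ z) (suc z)
    partner : Σ ℕ λ b' → b' < suc z × (pair (unpair₁ z) b' ≡ᵇ z) ≡ true
    partner = any<-elim _ (suc z)
      (least-found hasPartner (suc z) a
        (any<-intro _ (suc z) b (≡⇒≡ᵇ-true {z} refl) (s≤s (pair-≥₂ a b)))
        (s≤s (pair-≥₁ a b)))
    b' = proj₁ partner
    hit = proj₂ (proj₂ partner)

unpair₂-pair : ∀ a b → unpair₂ (pair a b) ≡ b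
unpair₂-pair a b = proj₂ (pair-injective a (unpair₂ z) a b (≡ᵇ-true hit))
  where
    z = pair a b
    matches : ℕ → Bool
    matches b' = pair (unpair₁ z) b' ≡ᵇ z
    matches-b : matches b ≡ true
    matches-b rewrite unpair₁-pair a b = ≡⇒≡ᵇ-true {z} refl
    hit : (pair a (unpair₂ z) ≡ᵇ z) ≡ true
    hit = subst (λ a' → (pair a' (unpair₂ z) ≡ᵇ z) ≡ true) (unpair₁-pair a b)
            (least-found matches (suc z) b matches-b (s≤s (pair-≥₂ a b)))

isEven-double : ∀ x → isEven (x + x) ≡ true
isEven-double zero = refl
isEven-double (suc x) rewrite +-suc x x = isEven-double x

isEven-double+1 : ∀ x → isEven (suc (x + x)) ≡ false
isEven-double+1 zero = refl
isEven-double+1 (suc x) rewrite +-suc x x = isEven-double+1 x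

half-double : ∀ x → half (x + x) ≡ x
half-double zero = refl
half-double (suc x) rewrite +-suc x x = cong suc (half-double x)

half-double+1 : ∀ x → half (suc (x + x)) ≡ x
half-double+1 zero = refl
half-double+1 (suc x) rewrite +-suc x x = cong suc (half-double+1 x)

join-left : ∀ f g x → (f ⊕ g) (x + x) ≡ f x
join-left f g x rewrite isEven-double x | half-double x = refl

join-right : ∀ f g x → (f ⊕ g) (suc (x + x)) ≡ g x
join-right f g x rewrite isEven-double+1 x | half-double+1 x = refl

module Computable (O : Baire) where
  C : (k : ℕ) → (Vec ℕ k → ℕ) → Set
  C = Comp O

  CP : (k : ℕ) → (Vec ℕ k → Bool) → Set
  CP k p = C k (λ xs → bit (p xs))

  constC : ∀ {k} (n : ℕ) → C k (λ _ → n)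
  constC zero = zeroC
  constC (suc n) = extC (compC sucC (λ _ → constC n)) (λ _ → refl)

  ap1 : ∀ {k} {g : ℕ → ℕ} {a} → C 1 (λ v → g (head v)) → C k a → C k (λ xs → g (a xs))
  ap1 gc ac = extC (compC gc (λ _ → ac)) (λ _ → refl)

  ap2 : ∀ {k} {g : ℕ → ℕ → ℕ} {a b} → C 2 (λ v → g (lookup v zero) (lookup v (suc zero))) →
        C k a → C k b → C k (λ xs → g (a xs) (b xs))
  ap2 {k} {a = a} {b} gc ac bc = extC (compC gc args) (λ _ → refl)
    where
      arg : Fin 2 → Vec ℕ k → ℕ
      arg zero = a
      arg (suc zero) = b
      args : (i : Fin 2) → C k (arg i)
      args zero = ac
      args (suc zero) = bc

  weaken : ∀ {k a} → C k a → C (suc k) (λ ys → a (tail ys))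
  weaken {k} {a} ac = extC (compC ac (λ i → projC (suc i))) (λ ys → cong a (tabulate-tail ys))
    where tabulate-tail : (ys : Vec ℕ (suc k)) → tabulate (λ i → lookup ys (suc i)) ≡ tail ys
          tabulate-tail (y ∷ ys) = tabulate∘lookup ys

  instFirst : ∀ {k F a} → C (suc k) F → C k a → C k (λ xs → F (a xs ∷ xs))
  instFirst {k} {F} {a} Fc ac =
      extC (compC Fc args) (λ xs → cong (λ v → F (a xs ∷ v)) (tabulate∘lookup xs))
    where
      arg : Fin (suc k) → Vec ℕ k → ℕ
      arg zero = a
      arg (suc i) = λ xs → lookup xs i
      args : (i : Fin (suc k)) → C k (arg i)
      args zero = ac
      args (suc i) = projC i

  oracleL : ∀ {k a} → C k a → C k (λ xs → O (a xs))
  oracleL = ap1 {g = O} oracleC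

  sucL : ∀ {k a} → C k a → C k (λ xs → suc (a xs))
  sucL = ap1 {g = suc} sucC

  addC : C 2 (λ v → lookup v zero + lookup v (suc zero))
  addC = extC (primrecC (projC zero) (sucL (projC zero))) add-eq
    where add-eq : ∀ xs → _ ≡ _
          add-eq (zero ∷ y ∷ []) = refl
          add-eq (suc x ∷ y ∷ []) = cong suc (add-eq (x ∷ y ∷ []))

  predC : C 1 (λ v → pred (head v))
  predC = extC (primrecC (constC 0) (projC (suc zero))) pred-eq
    where pred-eq : ∀ xs → _ ≡ _
          pred-eq (zero ∷ []) = refl
          pred-eq (suc x ∷ []) = refl

  -- Truncated subtraction  x ∸ n , recursing on  n .
  monusFlipC : C 2 (λ v → lookup v (suc zero) ∸ lookup v zero)
  monusFlipC = extC (primrecC (projC zero) (ap1 {g = pred} predC (projC zero))) monus-eq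
    where
      pred-∸ : ∀ x n → pred (x ∸ n) ≡ x ∸ suc n
      pred-∸ zero zero = refl
      pred-∸ zero (suc n) = refl
      pred-∸ (suc x) zero = refl
      pred-∸ (suc x) (suc n) = pred-∸ x n
      monus-eq : ∀ xs → _ ≡ _
      monus-eq (zero ∷ x ∷ []) = refl
      monus-eq (suc n ∷ x ∷ []) = trans (cong pred (monus-eq (n ∷ x ∷ []))) (pred-∸ x n)

  mulC : C 2 (λ v → lookup v zero * lookup v (suc zero))
  mulC = extC (primrecC (constC 0) (ap2 {g = _+_} addC (projC (suc (suc zero))) (projC zero))) mul-eq
    where mul-eq : ∀ xs → _ ≡ _
          mul-eq (zero ∷ y ∷ []) = refl
          mul-eq (suc x ∷ y ∷ []) = cong (y +_) (mul-eq (x ∷ y ∷ []))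

  _+C_ : ∀ {k a b} → C k a → C k b → C k (λ xs → a xs + b xs)
  ac +C bc = ap2 {g = _+_} addC ac bc

  _∸C_ : ∀ {k a b} → C k a → C k b → C k (λ xs → a xs ∸ b xs)
  ac ∸C bc = ap2 {g = λ n x → x ∸ n} monusFlipC bc ac

  _*C_ : ∀ {k a b} → C k a → C k b → C k (λ xs → a xs * b xs)
  ac *C bc = ap2 {g = _*_} mulC ac bc

  -- Definition by cases:  bit b * x + (1 ∸ bit b) * y .
  ifC : ∀ {k b x y} → CP k b → C k x → C k y → C k (λ xs → if b xs then x xs else y xs)
  ifC {b = b} {x} {y} bc xc yc = extC ((bc *C xc) +C ((constC 1 ∸C bc) *C yc)) by-cases
    where by-cases : ∀ xs → bit (b xs) * x xs + (1 ∸ bit (b xs)) * y xs ≡ (if b xs then x xs else y xs)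
          by-cases xs with b xs
          ... | true = trans (+-identityʳ (x xs + 0)) (+-identityʳ (x xs))
          ... | false = +-identityʳ (y xs)

  notC : ∀ {k b} → CP k b → CP k (λ xs → not (b xs))
  notC {b = b} bc = extC (ifC bc (constC 0) (constC 1)) by-cases
    where by-cases : ∀ xs → (if b xs then 0 else 1) ≡ bit (not (b xs))
          by-cases xs with b xs
          ... | true = refl
          ... | false = refl

  andC : ∀ {k b c} → CP k b → CP k c → CP k (λ xs → b xs ∧ c xs)
  andC {b = b} {c} bc cc = extC (ifC bc cc (constC 0)) by-cases
    where by-cases : ∀ xs → (if b xs then bit (c xs) else 0) ≡ bit (b xs ∧ c xs)
          by-cases xs with b xs
          ... | true = refl
          ... | false = refl

  orC : ∀ {k b c} → CP k b → CP k c → CP k (λ xs → b xs ∨ c xs)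
  orC {b = b} {c} bc cc = extC (ifC bc (constC 1) cc) by-cases
    where by-cases : ∀ xs → (if b xs then 1 else bit (c xs)) ≡ bit (b xs ∨ c xs)
          by-cases xs with b xs
          ... | true = refl
          ... | false = refl

  -- x = y  iff  1 ∸ ((x ∸ y) + (y ∸ x)) = 1 .
  eqC : ∀ {k a b} → C k a → C k b → CP k (λ xs → a xs ≡ᵇ b xs)
  eqC {a = a} {b} ac bc = extC (constC 1 ∸C ((ac ∸C bc) +C (bc ∸C ac))) (λ xs → eq-bit (a xs) (b xs))
    where eq-bit : ∀ x y → 1 ∸ ((x ∸ y) + (y ∸ x)) ≡ bit (x ≡ᵇ y)
          eq-bit zero zero = refl
          eq-bit zero (suc y) = 0∸n≡0 y
          eq-bit (suc x) zero = 0∸n≡0 (x + (0 ∸ suc x))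
          eq-bit (suc x) (suc y) = eq-bit x y

  -- x < y  iff  1 ∸ (1 ∸ (y ∸ x)) = 1 .
  ltC : ∀ {k a b} → C k a → C k b → CP k (λ xs → a xs <ᵇ b xs)
  ltC {a = a} {b} ac bc = extC (constC 1 ∸C (constC 1 ∸C (bc ∸C ac))) (λ xs → lt-bit (a xs) (b xs))
    where lt-bit : ∀ x y → 1 ∸ (1 ∸ (y ∸ x)) ≡ bit (x <ᵇ y)
          lt-bit zero zero = refl
          lt-bit zero (suc y) = cong (1 ∸_) (0∸n≡0 y)
          lt-bit (suc x) zero = refl
          lt-bit (suc x) (suc y) = lt-bit x y

  leastBoundC : ∀ {k p} → CP (suc k) p → C (suc k) (λ ys → least (λ y → p (y ∷ tail ys)) (head ys))
  leastBoundC {k} {p} pc = extC (primrecC (constC 0) stepC) least-eq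
    where
      stepC : C (suc (suc k)) (λ ys → searchStep (lookup ys zero) (lookup ys (suc zero)) (p (tail ys)))
      stepC = ifC (ltC (projC zero) (projC (suc zero))) (projC zero)
                  (ifC (weaken pc) (projC (suc zero)) (sucL (projC (suc zero))))
      least-eq : ∀ xs → _ ≡ _
      least-eq (zero ∷ xs) = sym (least-zero _)
      least-eq (suc s ∷ xs) = trans (cong (λ r → searchStep r s (p (s ∷ xs))) (least-eq (s ∷ xs)))
                                    (sym (least-suc _ s))

  leastC : ∀ {k p s} → CP (suc k) p → C k s → C k (λ xs → least (λ y → p (y ∷ xs)) (s xs))
  leastC pc sc = instFirst (leastBoundC pc) sc

  any<C : ∀ {k p s} → CP (suc k) p → C k s → CP k (λ xs → any< (λ y → p (y ∷ xs)) (s xs))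
  any<C pc sc = ltC (leastC pc sc) sc

  searchC : ∀ {k p} → CP (suc k) p → (W : ∀ xs → Σ ℕ λ y → p (y ∷ xs) ≡ true) →
            C k (λ xs → least (λ y → p (y ∷ xs)) (suc (proj₁ (W xs))))
  searchC {k} {p} pc W = minC (notC pc) _ hit below
    where
      found : ∀ xs → p (least (λ y → p (y ∷ xs)) (suc (proj₁ (W xs))) ∷ xs) ≡ true
      found xs = least-found (λ y → p (y ∷ xs)) _ (proj₁ (W xs)) (proj₂ (W xs)) ≤-refl
      hit : ∀ xs → bit (not (p (least (λ y → p (y ∷ xs)) (suc (proj₁ (W xs))) ∷ xs))) ≡ 0
      hit xs rewrite found xs = refl
      below : ∀ xs y → y < least (λ y → p (y ∷ xs)) (suc (proj₁ (W xs))) → bit (not (p (y ∷ xs))) ≢ 0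
      below xs y y< rewrite least-minimal (λ y → p (y ∷ xs)) _ y y< = λ ()

  triC : C 1 (λ v → tri (head v))
  triC = extC (primrecC (constC 0) (ap2 {g = _+_} addC (sucL (projC (suc zero))) (projC zero))) tri-eq
    where tri-eq : ∀ xs → _ ≡ _
          tri-eq (zero ∷ []) = refl
          tri-eq (suc n ∷ []) = cong (suc n +_) (tri-eq (n ∷ []))

  pairL : ∀ {k a b} → C k a → C k b → C k (λ xs → pair (a xs) (b xs))
  pairL ac bc = ap1 {g = tri} triC (ac +C bc) +C bc

  unpair₁L : ∀ {k a} → C k a → C k (λ xs → unpair₁ (a xs))
  unpair₁L = ap1 {g = unpair₁} (extC (leastC (any<C (eqC (pairL (projC (suc zero)) (projC zero)) (projC (suc (suc zero))))
                                       (sucL (projC (suc zero))))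
                               (sucL (projC zero)))
                       λ { (z ∷ []) → refl })

  unpair₂L : ∀ {k a} → C k a → C k (λ xs → unpair₂ (a xs))
  unpair₂L = ap1 {g = unpair₂} (extC (leastC (eqC (pairL (unpair₁L (projC (suc zero))) (projC zero)) (projC (suc zero)))
                               (sucL (projC zero)))
                       λ { (z ∷ []) → refl })

module GraphTests (c h : Baire) where
  memB : ℕ → Bool
  memB x = h x ≡ᵇ 1

  edgeB : ℕ → ℕ → Bool
  edgeB x y = not (x ≡ᵇ y) ∧ (c (pair x y) ≡ᵇ 1)

  hnbrB : ℕ → ℕ → Bool
  hnbrB x y = memB y ∧ edgeB x y

  memB-sound : ∀ {x} → memB x ≡ true → Mem h x
  memB-sound = ≡ᵇ-true

  memB-complete : ∀ {x} → Mem h x → memB x ≡ true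
  memB-complete = ≡⇒≡ᵇ-true

  edgeB-sound : ∀ {x y} → edgeB x y ≡ true → Edge c x y
  edgeB-sound e = let (distinct , coded) = ∧-split e in ≡ᵇ-false (not-true distinct) , ≡ᵇ-true coded

  edgeB-complete : ∀ {x y} → Edge c x y → edgeB x y ≡ true
  edgeB-complete (x≢y , coded) = ∧-intro (false-not (≢⇒≡ᵇ-false x≢y)) (≡⇒≡ᵇ-true coded)

  hnbrB-sound : ∀ {x y} → hnbrB x y ≡ true → HcapN c h x y
  hnbrB-sound e = let (m , ed) = ∧-split e in memB-sound m , edgeB-sound ed

  hnbrB-complete : ∀ {x y} → HcapN c h x y → hnbrB x y ≡ true
  hnbrB-complete (m , ed) = ∧-intro (memB-complete m) (edgeB-complete ed)

  open Computable (c ⊕ h)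

  cL : ∀ {k a} → C k a → C k (λ xs → c (a xs))
  cL {a = a} ac = extC (oracleL (ac +C ac)) (λ xs → join-left c h (a xs))

  hL : ∀ {k a} → C k a → C k (λ xs → h (a xs))
  hL {a = a} ac = extC (oracleL (sucL (ac +C ac))) (λ xs → join-right c h (a xs))

  memL : ∀ {k a} → C k a → CP k (λ xs → memB (a xs))
  memL ac = eqC (hL ac) (constC 1)

  edgeL : ∀ {k a b} → C k a → C k b → CP k (λ xs → edgeB (a xs) (b xs))
  edgeL ac bc = andC (notC (eqC ac bc)) (eqC (cL (pairL ac bc)) (constC 1))

  hnbrL : ∀ {k a b} → C k a → C k b → CP k (λ xs → hnbrB (a xs) (b xs))
  hnbrL ac bc = andC (memL bc) (edgeL ac bc)

module Greedy (c h : Baire) (edge-sym : ∀ u v → Edge c u v → Edge c v u)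
              (inV : ∀ x → Mem h x → Vtx c x) (Y : ℕ → Bool) where
  open GraphTests c h

  -- Keep x ∈ H with Y x unless a smaller H-neighbour of x satisfies Y.
  -- The result is an independent set.
  blockers : ℕ → ℕ → Bool
  blockers x y = Y y ∧ hnbrB x y

  greedy : ℕ → Bool
  greedy x = memB x ∧ (Y x ∧ not (any< (blockers x) x))

  greedy-intro : ∀ {x} → Mem h x → Y x ≡ true → (∀ y → y < x → Y y ≡ true → ¬ HcapN c h x y) →
                 greedy x ≡ true
  greedy-intro {x} mx yx none = ∧-intro (memB-complete mx) (∧-intro yx (false-not (¬true⇒false no-blocker)))
    where no-blocker : ¬ (any< (blockers x) x ≡ true)
          no-blocker e = let (y , y<x , hit) = any<-elim (blockers x) x e
                             (yy , nb) = ∧-split {Y y} hit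
                         in none y y<x yy (hnbrB-sound nb)

  greedy-mem : ∀ {x} → greedy x ≡ true → Mem h x
  greedy-mem {x} gx = memB-sound (proj₁ (∧-split {memB x} gx))

  greedy-Y : ∀ {x} → greedy x ≡ true → Y x ≡ true
  greedy-Y {x} gx = proj₁ (∧-split {Y x} (proj₂ (∧-split {memB x} gx)))

  greedy-blocked : ∀ {x} → greedy x ≡ true → any< (blockers x) x ≡ false
  greedy-blocked {x} gx = not-true (proj₂ (∧-split {Y x} (proj₂ (∧-split {memB x} gx))))

  greedy-no-smaller-nbr : ∀ {x y} → greedy x ≡ true → greedy y ≡ true → y < x → ¬ Edge c x y
  greedy-no-smaller-nbr {x} {y} gx gy y<x ed
    with trans (sym (any<-intro (blockers x) x y (∧-intro (greedy-Y gy) (hnbrB-complete (greedy-mem gy , ed))) y<x))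
               (greedy-blocked gx)
  ... | ()

  greedy-independent : ∀ {x y} → greedy x ≡ true → greedy y ≡ true → ¬ Edge c x y
  greedy-independent {x} {y} gx gy ed with <-cmp x y
  ... | tri< x<y _ _ = greedy-no-smaller-nbr gy gx x<y (edge-sym x y ed)
  ... | tri≈ _ refl _ = proj₁ ed refl
  ... | tri> _ _ y<x = greedy-no-smaller-nbr gx gy y<x ed

  -- An infinite greedy set is a solution of wRSgr: all degrees are 0.
  greedy-solution : Infinite (λ x → greedy x ≡ true) → sol wRSgr c (λ x → bit (greedy x))
  greedy-solution inf = (λ x gx → inV x (greedy-mem (bit-true gx)))
                      , (λ N → let (x , N≤x , gx) = inf N in x , N≤x , true-bit gx)
                      , λ v gv → inj₂ λ y (gy , ed) → greedy-independent (bit-true gv) (bit-true gy) ed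

  open Computable (c ⊕ h)

  greedyL : (∀ {k a} → C k a → CP k (λ xs → Y (a xs))) → CP 1 (λ v → greedy (head v))
  greedyL YL = extC (andC (memL (projC zero))
                          (andC (YL (projC zero))
                                (notC (any<C (andC (YL (projC zero)) (hnbrL (projC (suc zero)) (projC zero)))
                                             (projC zero)))))
                    λ { (x ∷ []) → refl }

module States (c h : Baire) where
  open GraphTests c h

  -- x ∈ H has the two distinct H-neighbours p and a; by the dichotomy
  -- satisfied by H, such an x has infinitely many H-neighbours.
  witnessB : ℕ → ℕ → ℕ → Bool
  witnessB x p a = memB x ∧ (not (p ≡ᵇ a) ∧ (hnbrB x p ∧ hnbrB x a))

  -- A valid state is a code  ⟨x, ⟨p, a⟩⟩  with  witnessB x p a .
  validB : ℕ → Bool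
  validB z = witnessB (unpair₁ z) (unpair₁ (unpair₂ z)) (unpair₂ (unpair₂ z))

  extendsB : ℕ → ℕ → ℕ → ℕ → Bool
  extendsB x n e a = (n <ᵇ e) ∧ (hnbrB x e ∧ (hnbrB e a ∧ not (a ≡ᵇ x)))

  -- The search for an extension runs over codes  w = ⟨e, a⟩ ; it accepts
  -- anything from an invalid state, so that it always terminates.
  foundB : ℕ → ℕ → ℕ → Bool
  foundB z n w = not (validB z) ∨ extendsB (unpair₁ z) n (unpair₁ w) (unpair₂ w)

  witness-intro : ∀ {x p a} → Mem h x → HcapN c h x p → HcapN c h x a → p ≢ a → witnessB x p a ≡ true
  witness-intro mx hp ha p≢a =
    ∧-intro (memB-complete mx) (∧-intro (false-not (≢⇒≡ᵇ-false p≢a)) (∧-intro (hnbrB-complete hp) (hnbrB-complete ha)))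

  witness-sound : ∀ {x p a} → witnessB x p a ≡ true → Mem h x × HcapN c h x p × HcapN c h x a × p ≢ a
  witness-sound {x} {p} {a} w =
    let (mx , rest) = ∧-split {memB x} w
        (distinct , nbrs) = ∧-split {not (p ≡ᵇ a)} rest
        (hp , ha) = ∧-split {hnbrB x p} nbrs
    in memB-sound mx , hnbrB-sound hp , hnbrB-sound ha , ≡ᵇ-false (not-true distinct)

  valid-sound : ∀ {z} → validB z ≡ true →
                Mem h (unpair₁ z) × HcapN c h (unpair₁ z) (unpair₁ (unpair₂ z))
                × HcapN c h (unpair₁ z) (unpair₂ (unpair₂ z)) × unpair₁ (unpair₂ z) ≢ unpair₂ (unpair₂ z)
  valid-sound {z} = witness-sound {unpair₁ z} {unpair₁ (unpair₂ z)} {unpair₂ (unpair₂ z)}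

  validB-pair : ∀ x p a → validB (pair x (pair p a)) ≡ witnessB x p a
  validB-pair x p a = begin
      witnessB (unpair₁ z) (unpair₁ (unpair₂ z)) (unpair₂ (unpair₂ z))
        ≡⟨ cong₂ (λ u q → witnessB u (unpair₁ q) (unpair₂ q)) (unpair₁-pair x (pair p a)) (unpair₂-pair x (pair p a)) ⟩
      witnessB x (unpair₁ (pair p a)) (unpair₂ (pair p a))
        ≡⟨ cong₂ (witnessB x) (unpair₁-pair p a) (unpair₂-pair p a) ⟩
      witnessB x p a ∎
    where open ≡-Reasoning
          z = pair x (pair p a)

  extends-intro : ∀ {x n e a} → n < e → HcapN c h x e → HcapN c h e a → a ≢ x → extendsB x n e a ≡ true
  extends-intro n<e he ha a≢x =
    ∧-intro (<⇒<ᵇ-true n<e) (∧-intro (hnbrB-complete he) (∧-intro (hnbrB-complete ha) (false-not (≢⇒≡ᵇ-false a≢x))))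

  extends-sound : ∀ {x n e a} → extendsB x n e a ≡ true → n < e × HcapN c h x e × HcapN c h e a × a ≢ x
  extends-sound {x} {n} {e} {a} ext =
    let (n<e , rest) = ∧-split {n <ᵇ e} ext
        (he , rest') = ∧-split {hnbrB x e} rest
        (ha , a≢x) = ∧-split {hnbrB e a} rest'
    in <ᵇ-true n<e , hnbrB-sound he , hnbrB-sound ha , ≡ᵇ-false (not-true a≢x)

  found-extends : ∀ {z n w} → validB z ≡ true → foundB z n w ≡ true →
                  extendsB (unpair₁ z) n (unpair₁ w) (unpair₂ w) ≡ true
  found-extends vz f rewrite vz = f

  open Computable (c ⊕ h)

  witnessL : ∀ {k x p a} → C k x → C k p → C k a → CP k (λ xs → witnessB (x xs) (p xs) (a xs))
  witnessL xc pc ac = andC (memL xc) (andC (notC (eqC pc ac)) (andC (hnbrL xc pc) (hnbrL xc ac)))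

  foundL : CP 3 (λ v → foundB (lookup v (suc zero)) (lookup v (suc (suc zero))) (lookup v zero))
  foundL = orC (notC (witnessL (unpair₁L z) (unpair₁L (unpair₂L z)) (unpair₂L (unpair₂L z))))
               (andC (ltC n e) (andC (hnbrL (unpair₁L z) e) (andC (hnbrL e a) (notC (eqC a (unpair₁L z))))))
    where
      w = projC {k = 3} zero
      z = projC {k = 3} (suc zero)
      n = projC {k = 3} (suc (suc zero))
      e = unpair₁L w
      a = unpair₂L w

module Tree (c h : Baire) (edge-sym : ∀ u v → Edge c u v → Edge c v u)
            (inV : ∀ x → Mem h x → Vtx c x)
            (root : ℕ) (root-valid : States.validB c h root ≡ true)
            (W : ∀ z n → Σ ℕ λ w → States.foundB c h z n w ≡ true) where
  open GraphTests c h
  open States c h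

  next : ℕ → ℕ → ℕ
  next z n = least (foundB z n) (suc (proj₁ (W z n)))

  next-found : ∀ z n → foundB z n (next z n) ≡ true
  next-found z n = least-found (foundB z n) _ (proj₁ (W z n)) (proj₂ (W z n)) ≤-refl

  step : ℕ → ℕ → ℕ
  step z n = pair (unpair₁ (next z n)) (pair (unpair₁ z) (unpair₂ (next z n)))

  step-valid : ∀ z n → validB z ≡ true →
               validB (step z n) ≡ true × n < unpair₁ (step z n) × HcapN c h (unpair₁ z) (unpair₁ (step z n))
  step-valid z n vz = new-valid , subst (n <_) (sym step-vertex) n<e , subst (HcapN c h x) (sym step-vertex) he
    where
      x = unpair₁ z
      e = unpair₁ (next z n)
      a = unpair₂ (next z n)
      extension : n < e × HcapN c h x e × HcapN c h e a × a ≢ x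
      extension = extends-sound (found-extends vz (next-found z n))
      n<e = proj₁ extension
      he = proj₁ (proj₂ extension)
      ha = proj₁ (proj₂ (proj₂ extension))
      a≢x = proj₂ (proj₂ (proj₂ extension))
      step-vertex : unpair₁ (step z n) ≡ e
      step-vertex = unpair₁-pair e (pair x a)
      new-valid : validB (step z n) ≡ true
      new-valid = trans (validB-pair e x a)
                        (witness-intro {e} {x} {a} (proj₁ he) (proj₁ (valid-sound vz) , edge-sym x e (proj₂ he)) ha
                                       (λ x≡a → a≢x (sym x≡a)))

  -- Node  n > 0  hangs below node  parent n < n ; every i is the parent of
  -- all the nodes  suc (pair i j) .
  parent : ℕ → ℕ
  parent n = if unpair₁ (pred n) <ᵇ n then unpair₁ (pred n) else 0

  parent-< : ∀ m → parent (suc m) ≤ m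
  parent-< m with unpair₁ m <ᵇ suc m in lt
  ... | true = s≤s⁻¹ (<ᵇ-true lt)
  ... | false = z≤n

  parent-pair : ∀ i j → parent (suc (pair i j)) ≡ i
  parent-pair i j = trans (if-true below) (unpair₁-pair i j)
    where below : (unpair₁ (pair i j) <ᵇ suc (pair i j)) ≡ true
          below = <⇒<ᵇ-true (s≤s (subst (_≤ pair i j) (sym (unpair₁-pair i j)) (pair-≥₁ i j)))

  ancestor : ℕ → ℕ → ℕ
  ancestor zero n = n
  ancestor (suc j) n = parent (ancestor j n)

  -- The state at node n is meant to satisfy  node 0 = root  and
  --   node (suc m) = step (node (parent (suc m))) (suc m) .
  -- This course-of-values recursion is realised by primitive recursion on t:
  -- stateAlong t n  is the state at the ancestor of n at distance  n ∸ t ,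
  -- computed along the chain of ancestors from the root downwards.
  stateStep : ℕ → ℕ → ℕ → ℕ
  stateStep r t n = if ancestor (n ∸ suc t) n ≡ᵇ 0 then root else step r (ancestor (n ∸ suc t) n)

  stateAlong : ℕ → ℕ → ℕ
  stateAlong zero n = root
  stateAlong (suc t) n = stateStep (stateAlong t n) t n

  node : ℕ → ℕ
  node n = stateAlong n n

  label : ℕ → ℕ
  label n = unpair₁ (node n)

  -- The set of labels; decidable because  n ≤ label n .
  inTree : ℕ → Bool
  inTree y = any< (λ n → label n ≡ᵇ y) (suc y)

  open Computable (c ⊕ h)

  nextL : C 2 (λ v → next (lookup v zero) (lookup v (suc zero)))
  nextL = extC (searchC foundL W-args) λ { (z ∷ n ∷ []) → refl }
    where W-args : ∀ xs → Σ ℕ λ w → foundB (lookup xs zero) (lookup xs (suc zero)) w ≡ true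
          W-args (z ∷ n ∷ []) = W z n

  stepL : ∀ {k z n} → C k z → C k n → C k (λ xs → step (z xs) (n xs))
  stepL zc nc = pairL (unpair₁L w) (pairL (unpair₁L zc) (unpair₂L w))
    where w = ap2 {g = next} nextL zc nc

  parentL : ∀ {k n} → C k n → C k (λ xs → parent (n xs))
  parentL nc = ifC (ltC u nc) u (constC 0)
    where u = unpair₁L (ap1 {g = pred} predC nc)

  ancestorL : C 2 (λ v → ancestor (lookup v zero) (lookup v (suc zero)))
  ancestorL = extC (primrecC (projC zero) (parentL (projC zero))) ancestor-eq
    where ancestor-eq : ∀ xs → _ ≡ _
          ancestor-eq (zero ∷ n ∷ []) = refl
          ancestor-eq (suc j ∷ n ∷ []) = cong parent (ancestor-eq (j ∷ n ∷ []))

  stateAlongL : C 2 (λ v → stateAlong (lookup v zero) (lookup v (suc zero)))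
  stateAlongL = extC (primrecC (constC root) stateStepL) along-eq
    where
      m = ap2 {g = ancestor} ancestorL (projC (suc (suc zero)) ∸C sucL (projC (suc zero))) (projC (suc (suc zero)))
      stateStepL : C 3 (λ v → stateStep (lookup v zero) (lookup v (suc zero)) (lookup v (suc (suc zero))))
      stateStepL = ifC (eqC m (constC 0)) (constC root) (stepL (projC zero) m)
      along-eq : ∀ xs → _ ≡ _
      along-eq (zero ∷ n ∷ []) = refl
      along-eq (suc t ∷ n ∷ []) = cong (λ r → stateStep r t n) (along-eq (t ∷ n ∷ []))

  labelL : C 1 (λ v → label (head v))
  labelL = extC (unpair₁L (ap2 {g = stateAlong} stateAlongL (projC zero) (projC zero))) λ { (n ∷ []) → refl }

  inTreeL : CP 1 (λ v → inTree (head v))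
  inTreeL = extC (any<C (eqC (ap1 {g = label} labelL (projC zero)) (projC (suc zero))) (sucL (projC zero)))
                 λ { (y ∷ []) → refl }

  -- Correctness, via the recursion with explicit fuel that stateAlong unfolds.
  nodeFuel : ℕ → ℕ → ℕ
  nodeFuel zero n = root
  nodeFuel (suc f) n = if n ≡ᵇ 0 then root else step (nodeFuel f (parent n)) n

  stateAlong-fuel : ∀ t n → t ≤ n → stateAlong t n ≡ nodeFuel t (ancestor (n ∸ t) n)
  stateAlong-fuel zero n _ = refl
  stateAlong-fuel (suc t) n st≤n =
    cong (λ r → if ancestor (n ∸ suc t) n ≡ᵇ 0 then root else step r (ancestor (n ∸ suc t) n))
         (trans (stateAlong-fuel t n (<⇒≤ st≤n))
                (cong (λ j → nodeFuel t (ancestor j n)) (+-∸-assoc 1 st≤n)))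

  node-fuel : ∀ n → node n ≡ nodeFuel n n
  node-fuel n = trans (stateAlong-fuel n n ≤-refl) (cong (λ j → nodeFuel n (ancestor j n)) (n∸n≡0 n))

  nodeFuel-zero : ∀ f → nodeFuel f 0 ≡ root
  nodeFuel-zero zero = refl
  nodeFuel-zero (suc f) = refl

  nodeFuel-stable : ∀ f g n → n ≤ f → n ≤ g → nodeFuel f n ≡ nodeFuel g n
  nodeFuel-stable f g zero _ _ = trans (nodeFuel-zero f) (sym (nodeFuel-zero g))
  nodeFuel-stable (suc f) (suc g) (suc m) (s≤s m≤f) (s≤s m≤g) =
    cong (λ r → step r (suc m))
         (nodeFuel-stable f g (parent (suc m)) (≤-trans (parent-< m) m≤f) (≤-trans (parent-< m) m≤g))

  node-suc : ∀ m → node (suc m) ≡ step (node (parent (suc m))) (suc m)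
  node-suc m = begin
      node (suc m)                                        ≡⟨ node-fuel (suc m) ⟩
      step (nodeFuel m (parent (suc m))) (suc m)          ≡⟨ cong (λ r → step r (suc m)) (nodeFuel-stable m p p (parent-< m) ≤-refl) ⟩
      step (nodeFuel p p) (suc m)                         ≡⟨ cong (λ r → step r (suc m)) (sym (node-fuel p)) ⟩
      step (node p) (suc m)                               ∎
    where open ≡-Reasoning
          p = parent (suc m)

  nodeFuel-valid : ∀ f n → validB (nodeFuel f n) ≡ true
  nodeFuel-valid zero n = root-valid
  nodeFuel-valid (suc f) n = valid-either (n ≡ᵇ 0)
    where valid-either : ∀ b → validB (if b then root else step (nodeFuel f (parent n)) n) ≡ true
          valid-either true = root-valid
          valid-either false = proj₁ (step-valid (nodeFuel f (parent n)) n (nodeFuel-valid f (parent n)))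

  node-valid : ∀ n → validB (node n) ≡ true
  node-valid n = subst (λ z → validB z ≡ true) (sym (node-fuel n)) (nodeFuel-valid n n)

  label-mem : ∀ n → Mem h (label n)
  label-mem n = proj₁ (valid-sound (node-valid n))

  label-child : ∀ m → suc m < label (suc m) × HcapN c h (label (parent (suc m))) (label (suc m))
  label-child m = subst (λ z → suc m < unpair₁ z × HcapN c h (label p) (unpair₁ z))
                        {step (node p) (suc m)} {node (suc m)} (sym (node-suc m))
                        (proj₂ (step-valid (node p) (suc m) (node-valid p)))
    where p = parent (suc m)

  label-≥ : ∀ n → n ≤ label n
  label-≥ zero = z≤n
  label-≥ (suc m) = <⇒≤ (proj₁ (label-child m))

  inTree-label : ∀ n → inTree (label n) ≡ true
  inTree-label n = any<-intro _ (suc (label n)) n (≡⇒≡ᵇ-true {label n} refl) (s≤s (label-≥ n))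

  inTree-sound : ∀ {y} → inTree y ≡ true → Σ ℕ λ n → label n ≡ y
  inTree-sound {y} e = let (n , _ , hit) = any<-elim (λ n → label n ≡ᵇ y) (suc y) e in n , ≡ᵇ-true hit

  -- Every node i has the children  suc (pair i N) , with labels at least N.
  tree-solution : sol wRSgr c (λ y → bit (inTree y))
  tree-solution = (λ y t → let (n , ln≡y) = inTree-sound (bit-true t) in subst (Vtx c) ln≡y (inV _ (label-mem n)))
                , (λ N → label N , label-≥ N , true-bit (inTree-label N))
                , λ v t → inj₁ (many-nbrs v (bit-true t))
    where
      many-nbrs : ∀ v → inTree v ≡ true → Infinite (HcapN c (λ y → bit (inTree y)) v)
      many-nbrs v t N = label child , N≤child , true-bit (inTree-label child)
                      , subst (λ u → Edge c u (label child)) parent-label (proj₂ (proj₂ (label-child (pair i N))))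
        where
          i = proj₁ (inTree-sound t)
          child = suc (pair i N)
          parent-label : label (parent child) ≡ v
          parent-label = trans (cong label (parent-pair i N)) (proj₂ (inTree-sound t))
          N≤child : N ≤ label child
          N≤child = ≤-trans (pair-≥₂ i N) (≤-trans (n≤1+n _) (label-≥ child))

finite⇒bounded : DoubleNegationElimination 0ℓ → (S : ℕ → Set) → ¬ Infinite S →
                 Σ ℕ λ B → ∀ m → B ≤ m → ¬ S m
finite⇒bounded dne S finite =
  dne λ unbounded → finite λ N → dne λ none → unbounded (N , λ m N≤m sm → none (m , N≤m , sm))

module Enumeration {S : ℕ → Set} (inf : Infinite S) (B : ℕ) where
  seq : ℕ → ℕ
  seq zero = proj₁ (inf B)
  seq (suc i) = proj₁ (inf (suc (seq i)))

  seq-mem : ∀ i → S (seq i)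
  seq-mem zero = proj₂ (proj₂ (inf B))
  seq-mem (suc i) = proj₂ (proj₂ (inf (suc (seq i))))

  seq-step : ∀ i → seq i < seq (suc i)
  seq-step i = proj₁ (proj₂ (inf (suc (seq i))))

  seq-≥ : ∀ i → B ≤ seq i
  seq-≥ zero = proj₁ (proj₂ (inf B))
  seq-≥ (suc i) = ≤-trans (seq-≥ i) (<⇒≤ (seq-step i))

  seq-mono : ∀ i j → i < j → seq i < seq j
  seq-mono i (suc j) i<sj with m≤n⇒m<n∨m≡n (s≤s⁻¹ i<sj)
  ... | inj₁ i<j = <-trans (seq-mono i j i<j) (seq-step j)
  ... | inj₂ refl = seq-step i

  seq-injective : ∀ i j → seq i ≡ seq j → i ≡ j
  seq-injective i j e with <-cmp i j
  ... | tri< i<j _ _ = ⊥-elim (<-irrefl e (seq-mono i j i<j))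
  ... | tri≈ _ i≡j _ = i≡j
  ... | tri> _ _ j<i = ⊥-elim (<-irrefl (sym e) (seq-mono j i j<i))

no-bounded-injection : ∀ B (p : ℕ → ℕ) → (∀ i → p i < B) → ¬ (∀ i j → p i ≡ p j → i ≡ j)
no-bounded-injection B p p<B injective with pigeonhole (n<1+n B) (λ i → fromℕ< (p<B (toℕ i)))
... | i , j , i<j , same = <-irrefl (injective (toℕ i) (toℕ j) p-same) i<j
  where p-same : p (toℕ i) ≡ p (toℕ j)
        p-same = trans (sym (toℕ-fromℕ< (p<B (toℕ i)))) (trans (cong toℕ same) (toℕ-fromℕ< (p<B (toℕ j))))

module Cases (em : ExcludedMiddle 0ℓ) (c h : Baire) (graph : IsInfGraph c) (H : sol wRSg c h) where
  open GraphTests c h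
  open Computable (c ⊕ h) using (constC)

  dne : DoubleNegationElimination 0ℓ
  dne = em⇒dne em

  edge-sym : ∀ u v → Edge c u v → Edge c v u
  edge-sym = proj₁ (proj₂ graph)

  inV : ∀ x → Mem h x → Vtx c x
  inV = proj₁ H

  H-infinite : Infinite (Mem h)
  H-infinite = proj₁ (proj₂ H)

  dichotomy : ∀ v → Mem h v → Infinite (HcapN c h v) ⊎ AtMostOne (HcapN c h v)
  dichotomy = proj₂ (proj₂ H)

  Solution : Set
  Solution = Σ Baire λ g → g ≤T (c ⊕ h) × sol wRSgr c g

  Rich : ℕ → Set
  Rich v = Infinite (HcapN c h v)

  two-nbrs⇒rich : ∀ {x p a} → Mem h x → HcapN c h x p → HcapN c h x a → p ≢ a → Rich x
  two-nbrs⇒rich {x} mx hp ha p≢a with dichotomy x mx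
  ... | inj₁ rich = rich
  ... | inj₂ atMostOne = ⊥-elim (p≢a (atMostOne _ _ hp ha))

  poor⇒atMostOne : ∀ {x} → Mem h x → ¬ Rich x → AtMostOne (HcapN c h x)
  poor⇒atMostOne {x} mx poor with dichotomy x mx
  ... | inj₁ rich = ⊥-elim (poor rich)
  ... | inj₂ atMostOne = atMostOne

  PoorNbr : ℕ → ℕ → Set
  PoorNbr v y = HcapN c h v y × ¬ Rich y

  -- Case A: some v ∈ H has infinitely many poor H-neighbours.  The only
  -- H-neighbour of such a y is v, which is not adjacent to itself, so
  -- every such y survives in the greedy subset of  H ∩ N(v) .
  caseA : ∀ v → Mem h v → Infinite (PoorNbr v) → Solution
  caseA v mv inf = _ , greedyL (edgeL (constC v)) , greedy-solution greedy-infinite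
    where
      open Greedy c h edge-sym inV (edgeB v)
      poor-nbr-greedy : ∀ {y} → PoorNbr v y → greedy y ≡ true
      poor-nbr-greedy {y} (hy , poor) =
        greedy-intro (proj₁ hy) (edgeB-complete (proj₂ hy)) λ z _ vz hz →
          proj₁ (edgeB-sound vz) (sym (poor⇒atMostOne (proj₁ hy) poor z v hz (mv , edge-sym v y (proj₂ hy))))
      greedy-infinite : Infinite (λ x → greedy x ≡ true)
      greedy-infinite N = let (y , N≤y , py) = inf N in y , N≤y , poor-nbr-greedy py

  -- Case B: no vertex of H has infinitely many poor H-neighbours, but some
  -- d ∈ H is rich.  Then rich vertices of H have infinitely many rich
  -- H-neighbours, so the extension searches of the tree construction
  -- terminate, and the tree grown from d solves wRSgr.
  module CaseB (noA : ∀ v → Mem h v → ¬ Infinite (PoorNbr v)) where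
    open States c h

    -- Only finitely many H-neighbours of d are poor, so infinitely many are rich.
    rich-nbrs : ∀ d → Mem h d → Rich d → Infinite (λ y → HcapN c h d y × Rich y)
    rich-nbrs d md rich N =
      let (B , few-poor) = finite⇒bounded dne _ (noA d md)
          (y , N+B≤y , hy) = rich (N + B)
      in y , ≤-trans (m≤m+n N B) N+B≤y , hy , dne λ poor → few-poor y (≤-trans (m≤n+m B N) N+B≤y) (hy , poor)

    -- A valid state certifies a rich vertex x; a rich H-neighbour e > n of x
    -- has an H-neighbour a > x, which gives an extension.
    extension-exists : ∀ z n → validB z ≡ true → Σ ℕ λ w → extendsB (unpair₁ z) n (unpair₁ w) (unpair₂ w) ≡ true
    extension-exists z n vz = pair e a , subst₂ (λ e' a' → extendsB x n e' a' ≡ true)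
                                                 (sym (unpair₁-pair e a)) (sym (unpair₂-pair e a))
                                                 (extends-intro n<e (proj₁ e-rich) (proj₂ (proj₂ a-nbr)) a≢x)
      where
        x = unpair₁ z
        witness = valid-sound vz
        x-rich : Rich x
        x-rich = two-nbrs⇒rich (proj₁ witness) (proj₁ (proj₂ witness)) (proj₁ (proj₂ (proj₂ witness)))
                               (proj₂ (proj₂ (proj₂ witness)))
        e-found = rich-nbrs x (proj₁ witness) x-rich (suc n)
        e = proj₁ e-found
        n<e = proj₁ (proj₂ e-found)
        e-rich = proj₂ (proj₂ e-found)
        a-nbr = proj₂ e-rich (suc x)
        a = proj₁ a-nbr
        a≢x : a ≢ x
        a≢x a≡x = <-irrefl (sym a≡x) (proj₁ (proj₂ a-nbr))

    search-terminates : ∀ z n → Σ ℕ λ w → foundB z n w ≡ true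
    search-terminates z n with validB z in vz
    ... | false = 0 , refl
    ... | true = extension-exists z n vz

    caseB : ∀ d → Mem h d → Rich d → Solution
    caseB d md rich = _ , inTreeL , tree-solution
      where
        p-nbr = rich 0
        a-nbr = rich (suc (proj₁ p-nbr))
        p = proj₁ p-nbr
        a = proj₁ a-nbr
        root-valid : validB (pair d (pair p a)) ≡ true
        root-valid = trans (validB-pair d p a)
                           (witness-intro md (proj₂ (proj₂ p-nbr)) (proj₂ (proj₂ a-nbr))
                                          (λ p≡a → <-irrefl p≡a (proj₁ (proj₂ a-nbr))))
        open Tree c h edge-sym inV (pair d (pair p a)) root-valid search-terminates

  -- A non-greedy element s of H above the
  -- bound B of a finite greedy set would have a smaller H-neighbour p whose
  -- only H-neighbour is s; p is greedy, so p < B, and s ↦ p is injective,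
  -- contradicting the pigeonhole principle.
  caseC : (∀ v → Mem h v → ¬ Rich v) → Solution
  caseC noRich = _ , greedyL (λ _ → constC 1) , greedy-solution greedy-infinite
    where
      open Greedy c h edge-sym inV (λ _ → true)

      lower-nbr : ∀ {x} → Mem h x → ¬ greedy x ≡ true → Σ ℕ λ p → p < x × HcapN c h p x × greedy p ≡ true
      lower-nbr {x} mx not-greedy = p , p<x , hpx , greedy-intro mp refl λ y y<p _ hy →
                                      <-irrefl (sym (poor⇒atMostOne mp (noRich p mp) x y hpx hy)) (<-trans y<p p<x)
        where
          blocked : any< (blockers x) x ≡ true
          blocked = ¬false⇒true λ unblocked → not-greedy (∧-intro (memB-complete mx) (false-not unblocked))
          blocker = any<-elim (blockers x) x blocked
          p = proj₁ blocker
          p<x = proj₁ (proj₂ blocker)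
          hxp = hnbrB-sound (proj₂ (∧-split {true} (proj₂ (proj₂ blocker))))
          mp = proj₁ hxp
          hpx : HcapN c h p x
          hpx = mx , edge-sym x p (proj₂ hxp)

      bounded-contradiction : (B : ℕ) → (∀ m → B ≤ m → ¬ greedy m ≡ true) → ⊥
      bounded-contradiction B none = no-bounded-injection B p p<B p-injective
        where
          open Enumeration H-infinite B
          nbr : ∀ i → Σ ℕ λ p → p < seq i × HcapN c h p (seq i) × greedy p ≡ true
          nbr i = lower-nbr (seq-mem i) (none (seq i) (seq-≥ i))
          p : ℕ → ℕ
          p i = proj₁ (nbr i)
          p-nbr : ∀ i → HcapN c h (p i) (seq i)
          p-nbr i = proj₁ (proj₂ (proj₂ (nbr i)))
          p-greedy : ∀ i → greedy (p i) ≡ true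
          p-greedy i = proj₂ (proj₂ (proj₂ (nbr i)))
          p-mem : ∀ i → Mem h (p i)
          p-mem i = greedy-mem (p-greedy i)
          p<B : ∀ i → p i < B
          p<B i = ≰⇒> λ B≤p → none (p i) B≤p (p-greedy i)
          p-injective : ∀ i j → p i ≡ p j → i ≡ j
          p-injective i j pi≡pj = seq-injective i j
            (poor⇒atMostOne (p-mem i) (noRich (p i) (p-mem i)) (seq i) (seq j) (p-nbr i)
                            (subst (λ q → HcapN c h q (seq j)) (sym pi≡pj) (p-nbr j)))

      greedy-infinite : Infinite (λ x → greedy x ≡ true)
      greedy-infinite = dne λ finite →
        let (B , none) = finite⇒bounded dne _ finite in bounded-contradiction B none

  solve : Solution
  solve with em {Σ ℕ λ v → Mem h v × Infinite (PoorNbr v)}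
  ... | yes (v , mv , inf) = caseA v mv inf
  ... | no noA with em {Σ ℕ λ d → Mem h d × Rich d}
  ...   | yes (d , md , rich) = CaseB.caseB (λ v mv inf → noA (v , mv , inf)) d md rich
  ...   | no noRich = caseC (λ v mv rich → noRich (v , mv , rich))

wRSgr≤wRSg : ExcludedMiddle 0ℓ → wRSgr ≤c wRSg
wRSgr≤wRSg em c graph = c , oracleC , graph , λ h H → Cases.solve em c h graph H

wRSg≤wRSgr : wRSg ≤c wRSgr
wRSg≤wRSgr c graph = c , oracleC , graph , answer
  where
    weaken : ∀ {S} → Infinite S ⊎ Empty S → Infinite S ⊎ AtMostOne S
    weaken (inj₁ inf) = inj₁ inf
    weaken (inj₂ empty) = inj₂ λ x _ sx _ → ⊥-elim (empty x sx)
    answer : (h : Baire) → sol wRSgr c h → Σ Baire λ g → g ≤T (c ⊕ h) × sol wRSg c g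
    answer h (inV , infinite , degrees) =
      h , extC (GraphTests.hL c h (projC zero)) (λ { (x ∷ []) → refl }) , inV , infinite , λ v mv → weaken (degrees v mv)

proposition6p4 : ExcludedMiddle 0ℓ → (wRSgr ≤c wRSg) × (wRSg ≡c wRSgr)
proposition6p4 em = wRSgr≤wRSg em , wRSg≤wRSgr , wRSgr≤wRSg em
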